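{- Let $A,B\subseteq S_n\times S_n$ be events that are increasing in the first coordinate and decreasing in the second coordinate with respect to the strong Bruhat order, and let $\mathbb{P}$ be the uniform probability measure on $S_n\times S_n$. Then $\mathbb{P}(A\cap B)\ge\mathbb{P}(A)\mathbb{P}(B)$.
   Context: A set $E\subseteq S_n$ is increasing if $\sigma_1\in E$ and $\sigma_2\ge\sigma_1$ imply $\sigma_2\in E$, and decreasing if $\sigma_1\in E$ and $\sigma_2\le\sigma_1$ imply $\sigma_2\in E$. $A\subseteq S_n\times S_n$ is increasing in the first coordinate if for each fixed $\tau$ the set $\{\pi:(\pi,\tau)\in A\}$ is increasing, and decreasing in the second coordinate if for each fixed $\pi$ the set $\{\tau:(\pi,\tau)\in A\}$ is decreasing. The strong Bruhat order: with $M_\sigma(i,j)=1$ iff $\sigma(i)=j$, $\pi\le\tau$ iff $\sum_{i\le a,j\le b}M_\tau(i,j)\le\sum_{i\le a,j\le b}M_\pi(i,j)$ for all $a,b\in[n]$. -}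

module Defs where

open import Data.Bool using (Bool; true; false; T; _∧_)
open import Data.Bool.Properties using (T?)
open import Data.Nat using (ℕ; zero; suc; _≤_; _*_)
open import Data.Nat.Properties using (_≤?_)
open import Data.Fin using (Fin; toℕ)
open import Data.Fin.Properties using (_≟_)
open import Data.Vec using (Vec; []; _∷_; lookup; toList)
open import Data.List using (List; [_]; map; concatMap; filter; length; allFin; cartesianProduct)
open import Data.List.Relation.Unary.Unique.Propositional using (Unique)
import Data.List.Relation.Unary.Unique.DecPropositional as UDec
open import Data.Product using (_×_; _,_; proj₁; proj₂)
open import Relation.Nullary.Decidable using (Dec; _×-dec_)

-- A permutation of [n] = Fin n is represented by its one-line notation
-- σ = (σ(0), …, σ(n-1)) : Vec (Fin n) n with pairwise distinct entries.
IsPerm : {n : ℕ} → Vec (Fin n) n → Set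
IsPerm σ = Unique (toList σ)

isPerm? : {n : ℕ} (σ : Vec (Fin n) n) → Dec (IsPerm σ)
isPerm? σ = UDec.unique? _≟_ (toList σ)

allVecs : (n k : ℕ) → List (Vec (Fin n) k)
allVecs n zero = [ [] ]
allVecs n (suc k) = concatMap (λ i → map (i ∷_) (allVecs n k)) (allFin n)

perms : (n : ℕ) → List (Vec (Fin n) n)
perms n = filter isPerm? (allVecs n n)

-- rank function: r σ a b = #{ i ≤ a : σ(i) ≤ b } = Σ_{i ≤ a, j ≤ b} M_σ(i,j)
rank : {n : ℕ} → Vec (Fin n) n → Fin n → Fin n → ℕ
rank {n} σ a b =
  length (filter (λ i → (toℕ i ≤? toℕ a) ×-dec (toℕ (lookup σ i) ≤? toℕ b)) (allFin n))

_≤B_ : {n : ℕ} → Vec (Fin n) n → Vec (Fin n) n → Set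
π ≤B τ = ∀ a b → rank τ a b ≤ rank π a b

-- an event in S_n × S_n, as a (decidable) indicator; only its values on
-- pairs of permutations matter
Event : ℕ → Set
Event n = Vec (Fin n) n → Vec (Fin n) n → Bool

IncreasingFst : {n : ℕ} → Event n → Set
IncreasingFst {n} A = ∀ (σ₁ σ₂ τ : Vec (Fin n) n) → IsPerm σ₁ → IsPerm σ₂ → IsPerm τ →
  σ₁ ≤B σ₂ → T (A σ₁ τ) → T (A σ₂ τ)

DecreasingSnd : {n : ℕ} → Event n → Set
DecreasingSnd {n} A = ∀ (π τ₁ τ₂ : Vec (Fin n) n) → IsPerm π → IsPerm τ₁ → IsPerm τ₂ →
  τ₂ ≤B τ₁ → T (A π τ₁) → T (A π τ₂)

_∩_ : {n : ℕ} → Event n → Event n → Event n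
(A ∩ B) σ τ = A σ τ ∧ B σ τ

pairs : (n : ℕ) → List (Vec (Fin n) n × Vec (Fin n) n)
pairs n = cartesianProduct (perms n) (perms n)

card : {n : ℕ} → Event n → ℕ
card {n} E = length (filter (λ p → T? (E (proj₁ p) (proj₂ p))) (pairs n))

-- Write a permutation σ of {0, …, n − 1} by its code (c₀, …, c_{n−1}) with cᵢ < n − i: σ(i) is
-- the cᵢ-th smallest value not among σ(0), …, σ(i − 1). Fix b and let kᵢ be the number of values
-- ≤ b still unused before step i; they are the kᵢ smallest unused values, so σ(i) ≤ b iff cᵢ < kᵢ,
-- and kᵢ₊₁ = kᵢ − [cᵢ < kᵢ]. This update is monotone in both cᵢ and kᵢ, and #{i ≤ a : σ(i) ≤ b}
-- equals b + 1 − kₐ₊₁, so raising the code componentwise lowers every rank: the product order on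
-- codes refines the Bruhat order. Hence the events of the theorem become, on pairs of codes,
-- increasing sets of a product of chains (reversed in the second factor), where Harris's
-- inequality holds: for a single chain it is Chebyshev's sum inequality, and it passes to
-- products because fibre sums of monotone functions are monotone.

module Submission where

open import Defs
open import Data.Nat using (ℕ; _≤_; _*_)
open import Data.List using (length)

open import Level using (0ℓ)
open import Data.Bool using (Bool; true; false; _∧_; T)
open import Data.Empty using (⊥-elim)
open import Data.Unit using (⊤; tt)
open import Data.Nat using (zero; suc; pred; _+_; z≤n; s≤s; _≤ᵇ_; _<ᵇ_)
open import Data.Nat.Properties
open import Data.Nat.ListAction using (sum)
open import Data.Nat.ListAction.Properties using (sum-++; sum-↭)
open import Data.Nat.Tactic.RingSolver using (solve-∀)
open import Data.Fin using (Fin; zero; suc; toℕ; punchIn; punchOut)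
import Data.Fin as Fin
import Data.Fin.Properties as Fin
open import Data.Fin.Properties using (punchIn-injective; punchInᵢ≢i)
open import Data.Product using (_×_; _,_; proj₁; proj₂; ∃-syntax)
open import Data.Product.Relation.Binary.Pointwise.NonDependent using (Pointwise)
open import Data.Sum using (inj₁; inj₂)
open import Data.Vec using (Vec; []; _∷_; lookup; removeAt; toList)
import Data.Vec as Vec
open import Data.Vec.Properties using (lookup-allFin; removeAt-punchOut; ∷-injectiveˡ; ∷-injectiveʳ)
open import Data.List
  using (List; []; _∷_; [_]; map; _++_; filter; concatMap; allFin; cartesianProduct; cartesianProductWith)
open import Data.List.Properties using (map-cong; map-∘; map-++; map-tabulate)
open import Data.List.Membership.Propositional using (_∈_)
open import Data.List.Membership.Propositional.Properties
  using (∈-cartesianProduct⁺; ∈-cartesianProductWith⁺; ∈-allFin; ∈-map⁺; ∈-map⁻; ∈-filter⁺; ∈-filter⁻)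
open import Data.List.Membership.Propositional.Properties.WithK using (unique∧set⇒bag)
open import Data.List.Relation.Binary.BagAndSetEquality using (∼bag⇒↭)
open import Data.List.Relation.Binary.Permutation.Propositional using (_↭_)
import Data.List.Relation.Binary.Permutation.Propositional.Properties as ↭
open import Data.List.Relation.Unary.All as All using (All; []; _∷_)
open import Data.List.Relation.Unary.AllPairs using ([]; _∷_)
open import Data.List.Relation.Unary.Any using (here)
open import Data.List.Relation.Unary.Unique.Propositional using (Unique)
import Data.List.Relation.Unary.Unique.Propositional.Properties as Unique
open import Function using (_∘_; id; flip)
open import Function.Bundles using (mk⇔)
open import Function.Definitions using (Injective)
open import Relation.Binary using (Rel; Reflexive; Total; _Preserves_⟶_)
open import Relation.Binary.PropositionalEquality hiding ([_])
open import Relation.Nullary using (does)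
open import Relation.Unary using (Pred; Decidable)

∑ : {A : Set} → List A → (A → ℕ) → ℕ
∑ xs f = sum (map f xs)

syntax ∑ xs (λ x → e) = ∑[ x ∈ xs ] e

module _ {A : Set} where

  ∑-cong : ∀ {f g : A → ℕ} xs → (∀ x → f x ≡ g x) → ∑ xs f ≡ ∑ xs g
  ∑-cong xs f≗g = cong sum (map-cong f≗g xs)

  ∑-mono : ∀ {f g : A → ℕ} xs → (∀ x → f x ≤ g x) → ∑ xs f ≤ ∑ xs g
  ∑-mono []       f≤g = z≤n
  ∑-mono (x ∷ xs) f≤g = +-mono-≤ (f≤g x) (∑-mono xs f≤g)

  ∑-+ : ∀ (f g : A → ℕ) xs → ∑[ x ∈ xs ] (f x + g x) ≡ ∑ xs f + ∑ xs g
  ∑-+ f g []       = refl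
  ∑-+ f g (x ∷ xs) rewrite ∑-+ f g xs = +-interchange (f x) (g x) (∑ xs f) (∑ xs g)
    where
    +-interchange : ∀ a b c d → (a + b) + (c + d) ≡ (a + c) + (b + d)
    +-interchange = solve-∀

  ∑-*ˡ : ∀ c (f : A → ℕ) xs → ∑[ x ∈ xs ] (c * f x) ≡ c * ∑ xs f
  ∑-*ˡ c f []       = sym (*-zeroʳ c)
  ∑-*ˡ c f (x ∷ xs) = trans (cong (c * f x +_) (∑-*ˡ c f xs)) (sym (*-distribˡ-+ c (f x) _))

  ∑-*ʳ : ∀ c (f : A → ℕ) xs → ∑[ x ∈ xs ] (f x * c) ≡ ∑ xs f * c
  ∑-*ʳ c f xs = trans (∑-cong xs (λ x → *-comm (f x) c)) (trans (∑-*ˡ c f xs) (*-comm c _))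

  ∑-const : ∀ c (xs : List A) → ∑[ _ ∈ xs ] c ≡ length xs * c
  ∑-const c []       = refl
  ∑-const c (x ∷ xs) = cong (c +_) (∑-const c xs)

  ∑-↭ : ∀ (f : A → ℕ) {xs ys} → xs ↭ ys → ∑ xs f ≡ ∑ ys f
  ∑-↭ f xs↭ys = sum-↭ (↭.map⁺ f xs↭ys)

  ∑-++ : ∀ (f : A → ℕ) xs ys → ∑ (xs ++ ys) f ≡ ∑ xs f + ∑ ys f
  ∑-++ f xs ys = trans (cong sum (map-++ f xs ys)) (sum-++ (map f xs) (map f ys))

  ∑-map : ∀ {B : Set} (f : B → ℕ) (g : A → B) xs → ∑ (map g xs) f ≡ ∑ xs (f ∘ g)
  ∑-map f g xs = cong sum (sym (map-∘ xs))

length≡∑1 : {A : Set} (xs : List A) → length xs ≡ ∑[ _ ∈ xs ] 1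
length≡∑1 xs = sym (trans (∑-const 1 xs) (*-identityʳ _))

∑-cartesianProduct : {A B : Set} (h : A × B → ℕ) (xs : List A) (ys : List B) →
  ∑ (cartesianProduct xs ys) h ≡ ∑[ x ∈ xs ] ∑[ y ∈ ys ] h (x , y)
∑-cartesianProduct h []       ys = refl
∑-cartesianProduct h (x ∷ xs) ys = trans (∑-++ h (map (x ,_) ys) _)
  (cong₂ _+_ (∑-map h (x ,_) ys) (∑-cartesianProduct h xs ys))

∑∑-* : {A B : Set} (f : A → ℕ) (g : B → ℕ) (xs : List A) (ys : List B) →
  ∑[ x ∈ xs ] ∑[ y ∈ ys ] (f x * g y) ≡ ∑ xs f * ∑ ys g
∑∑-* f g xs ys = trans (∑-cong xs (λ x → ∑-*ˡ (f x) g ys)) (∑-*ʳ (∑ ys g) f xs)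

length-cartesianProduct : {A B : Set} (xs : List A) (ys : List B) →
  length (cartesianProduct xs ys) ≡ length xs * length ys
length-cartesianProduct xs ys = begin
  length (cartesianProduct xs ys)      ≡⟨ length≡∑1 (cartesianProduct xs ys) ⟩
  ∑ (cartesianProduct xs ys) (λ _ → 1) ≡⟨ ∑-cartesianProduct _ xs ys ⟩
  ∑[ _ ∈ xs ] ∑[ _ ∈ ys ] 1            ≡⟨ ∑-cong xs (λ _ → sym (length≡∑1 ys)) ⟩
  ∑[ _ ∈ xs ] length ys                ≡⟨ ∑-const (length ys) xs ⟩
  length xs * length ys                ∎
  where open ≡-Reasoning

𝟙 : Bool → ℕ
𝟙 true  = 1
𝟙 false = 0

𝟙-∧ : ∀ a b → 𝟙 (a ∧ b) ≡ 𝟙 a * 𝟙 b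
𝟙-∧ false b     = refl
𝟙-∧ true  false = refl
𝟙-∧ true  true  = refl

length-filter≡∑ : {A : Set} {P : Pred A 0ℓ} (P? : Decidable P) (xs : List A) →
                  length (filter P? xs) ≡ ∑[ x ∈ xs ] 𝟙 (does (P? x))
length-filter≡∑ P? []       = refl
length-filter≡∑ P? (x ∷ xs) with does (P? x)
... | true  = cong suc (length-filter≡∑ P? xs)
... | false = length-filter≡∑ P? xs

∑-allFin-suc : ∀ {k} (f : Fin (suc k) → ℕ) → ∑ (allFin (suc k)) f ≡ f zero + ∑ (allFin k) (f ∘ suc)
∑-allFin-suc f = cong (λ xs → f zero + sum xs)
  (trans (map-tabulate suc f) (sym (map-tabulate id (f ∘ suc))))

𝟙-mono : ∀ {a b} → (T a → T b) → 𝟙 a ≤ 𝟙 b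
𝟙-mono {false}        _ = z≤n
𝟙-mono {true} {true}  _ = ≤-refl
𝟙-mono {true} {false} h = ⊥-elim (h tt)

-- The two sides differ by (b − a) * (d − c).
rearrangement : ∀ {a b c d} → a ≤ b → c ≤ d → a * d + b * c ≤ a * c + b * d
rearrangement {a} {c = c} a≤b c≤d with m≤n⇒∃[o]m+o≡n a≤b | m≤n⇒∃[o]m+o≡n c≤d
... | p , refl | q , refl = begin
  a * (c + q) + (a + p) * c          ≤⟨ m≤m+n _ (p * q) ⟩
  a * (c + q) + (a + p) * c + p * q  ≡⟨ expand a c p q ⟩
  a * c + (a + p) * (c + q)          ∎
  where
  open ≤-Reasoning
  expand : ∀ a c p q → a * (c + q) + (a + p) * c + p * q ≡ a * c + (a + p) * (c + q)
  expand = solve-∀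

halve-≤ : ∀ {m n} → m + m ≤ n + n → m ≤ n
halve-≤ m+m≤n+n = ≮⇒≥ (λ n<m → <⇒≱ (+-mono-< n<m n<m) m+m≤n+n)

HarrisProperty : {A : Set} → Rel A 0ℓ → List A → Set
HarrisProperty R xs = ∀ f g → f Preserves R ⟶ _≤_ → g Preserves R ⟶ _≤_ →
  ∑ xs f * ∑ xs g ≤ length xs * ∑[ x ∈ xs ] (f x * g x)

module _ {A : Set} {R : Rel A 0ℓ} where

  harris-total : Total R → ∀ xs → HarrisProperty R xs
  harris-total total xs f g f↑ g↑ = halve-≤ (begin
    ∑ xs f * ∑ xs g + ∑ xs f * ∑ xs g                ≡⟨ mixed ⟨
    ∑[ x ∈ xs ] ∑[ y ∈ xs ] (f x * g y + f y * g x)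
      ≤⟨ ∑-mono xs (λ x → ∑-mono xs (similarly-ordered x)) ⟩
    ∑[ x ∈ xs ] ∑[ y ∈ xs ] (h x + h y)              ≡⟨ diagonal ⟩
    length xs * ∑ xs h + length xs * ∑ xs h          ∎)
    where
    open ≤-Reasoning
    h : A → ℕ
    h x = f x * g x

    similarly-ordered : ∀ x y → f x * g y + f y * g x ≤ h x + h y
    similarly-ordered x y with total x y
    ... | inj₁ xRy = rearrangement (f↑ xRy) (g↑ xRy)
    ... | inj₂ yRx = begin
      f x * g y + f y * g x  ≡⟨ +-comm (f x * g y) _ ⟩
      f y * g x + f x * g y  ≤⟨ rearrangement (f↑ yRx) (g↑ yRx) ⟩
      h y + h x              ≡⟨ +-comm (h y) _ ⟩
      h x + h y              ∎

    mixed : ∑[ x ∈ xs ] ∑[ y ∈ xs ] (f x * g y + f y * g x) ≡ ∑ xs f * ∑ xs g + ∑ xs f * ∑ xs g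
    mixed = begin-equality
      ∑[ x ∈ xs ] ∑[ y ∈ xs ] (f x * g y + f y * g x)
        ≡⟨ ∑-cong xs (λ x → ∑-+ (λ y → f x * g y) (λ y → f y * g x) xs) ⟩
      ∑[ x ∈ xs ] (∑[ y ∈ xs ] (f x * g y) + ∑[ y ∈ xs ] (f y * g x))
        ≡⟨ ∑-+ _ _ xs ⟩
      ∑[ x ∈ xs ] ∑[ y ∈ xs ] (f x * g y) + ∑[ x ∈ xs ] ∑[ y ∈ xs ] (f y * g x)
        ≡⟨ cong (∑[ x ∈ xs ] ∑[ y ∈ xs ] (f x * g y) +_)
                (∑-cong xs (λ x → ∑-cong xs (λ y → *-comm (f y) (g x)))) ⟩
      ∑[ x ∈ xs ] ∑[ y ∈ xs ] (f x * g y) + ∑[ x ∈ xs ] ∑[ y ∈ xs ] (g x * f y)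
        ≡⟨ cong₂ _+_ (∑∑-* f g xs xs) (trans (∑∑-* g f xs xs) (*-comm (∑ xs g) _)) ⟩
      ∑ xs f * ∑ xs g + ∑ xs f * ∑ xs g  ∎

    diagonal : ∑[ x ∈ xs ] ∑[ y ∈ xs ] (h x + h y) ≡ length xs * ∑ xs h + length xs * ∑ xs h
    diagonal = begin-equality
      ∑[ x ∈ xs ] ∑[ y ∈ xs ] (h x + h y)             ≡⟨ ∑-cong xs (λ x → ∑-+ (λ _ → h x) h xs) ⟩
      ∑[ x ∈ xs ] (∑[ _ ∈ xs ] h x + ∑ xs h)          ≡⟨ ∑-+ _ _ xs ⟩
      ∑[ x ∈ xs ] ∑[ _ ∈ xs ] h x + ∑[ _ ∈ xs ] ∑ xs h
        ≡⟨ cong₂ _+_ (trans (∑-cong xs (λ x → ∑-const (h x) xs)) (∑-*ˡ (length xs) h xs))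
                     (∑-const (∑ xs h) xs) ⟩
      length xs * ∑ xs h + length xs * ∑ xs h         ∎

module _ {A B : Set} {R : Rel A 0ℓ} {Q : Rel B 0ℓ} where

  harris-× : Reflexive R → Reflexive Q → ∀ {xs ys} → HarrisProperty R xs → HarrisProperty Q ys →
             HarrisProperty (Pointwise R Q) (cartesianProduct xs ys)
  harris-× refl-R refl-Q {xs} {ys} harris-xs harris-ys f g f↑ g↑ = begin
    ∑ xys f * ∑ xys g
      ≡⟨ cong₂ _*_ (∑-cartesianProduct f xs ys) (∑-cartesianProduct g xs ys) ⟩
    ∑ xs F * ∑ xs G                              ≤⟨ harris-xs F G F↑ G↑ ⟩
    length xs * ∑[ x ∈ xs ] (F x * G x)          ≤⟨ *-monoʳ-≤ (length xs) (∑-mono xs fibre) ⟩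
    length xs * ∑[ x ∈ xs ] (length ys * H x)    ≡⟨ cong (length xs *_) (∑-*ˡ (length ys) H xs) ⟩
    length xs * (length ys * ∑ xs H)             ≡⟨ *-assoc (length xs) _ _ ⟨
    length xs * length ys * ∑ xs H
      ≡⟨ cong₂ _*_ (length-cartesianProduct xs ys) (∑-cartesianProduct (λ p → f p * g p) xs ys) ⟨
    length xys * ∑[ p ∈ xys ] (f p * g p)        ∎
    where
    open ≤-Reasoning
    xys : List (A × B)
    xys = cartesianProduct xs ys
    F G H : A → ℕ
    F x = ∑[ y ∈ ys ] f (x , y)
    G x = ∑[ y ∈ ys ] g (x , y)
    H x = ∑[ y ∈ ys ] (f (x , y) * g (x , y))
    F↑ : F Preserves R ⟶ _≤_
    F↑ xRx′ = ∑-mono ys (λ _ → f↑ (xRx′ , refl-Q))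
    G↑ : G Preserves R ⟶ _≤_
    G↑ xRx′ = ∑-mono ys (λ _ → g↑ (xRx′ , refl-Q))
    fibre : ∀ x → F x * G x ≤ length ys * H x
    fibre x = harris-ys (λ y → f (x , y)) (λ y → g (x , y))
                        (λ yQy′ → f↑ (refl-R , yQy′)) (λ yQy′ → g↑ (refl-R , yQy′))

Code : ℕ → Set
Code zero    = ⊤
Code (suc k) = Fin (suc k) × Code k

codes : (k : ℕ) → List (Code k)
codes zero    = [ tt ]
codes (suc k) = cartesianProduct (allFin (suc k)) (codes k)

CodeRel : (∀ {m} → Rel (Fin m) 0ℓ) → ∀ {k} → Rel (Code k) 0ℓ
CodeRel R {zero}  _ _ = ⊤
CodeRel R {suc k}     = Pointwise R (CodeRel R)

module _ {R : ∀ {m} → Rel (Fin m) 0ℓ} (refl-R : ∀ {m} → Reflexive (R {m})) where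

  CodeRel-refl : ∀ {k} → Reflexive (CodeRel R {k})
  CodeRel-refl {zero}  = tt
  CodeRel-refl {suc k} = refl-R , CodeRel-refl {k}

  harris-codes : (∀ {m} → Total (R {m})) → ∀ k → HarrisProperty (CodeRel R) (codes k)
  harris-codes total zero    = harris-total (λ _ _ → inj₁ tt) [ tt ]
  harris-codes total (suc k) =
    harris-× refl-R (CodeRel-refl {k}) {allFin (suc k)} {codes k}
      (harris-total total (allFin (suc k))) (harris-codes total k)

CodeRel-≥⇒≤ : ∀ {k} {c c′ : Code k} → CodeRel Fin._≥_ c c′ → CodeRel Fin._≤_ c′ c
CodeRel-≥⇒≤ {zero}  _             = tt
CodeRel-≥⇒≤ {suc k} (c≥c′ , cs≥cs′) = c≥c′ , CodeRel-≥⇒≤ {k} cs≥cs′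

∈-codes : ∀ {k} (c : Code k) → c ∈ codes k
∈-codes {zero}  tt       = here refl
∈-codes {suc k} (c , cs) = ∈-cartesianProduct⁺ (∈-allFin c) (∈-codes cs)

codes-unique : ∀ k → Unique (codes k)
codes-unique zero    = [] ∷ []
codes-unique (suc k) = Unique.cartesianProduct⁺ (Unique.allFin⁺ (suc k)) (codes-unique k)

decodeFrom : {A : Set} → ∀ {k} → Vec A k → Code k → Vec A k
decodeFrom {k = zero}  []  _        = []
decodeFrom {k = suc k} xs (c , cs) = lookup xs c ∷ decodeFrom (removeAt xs c) cs

decode : ∀ {n} → Code n → Vec (Fin n) n
decode {n} = decodeFrom (Vec.allFin n)

lookup-removeAt : {A : Set} → ∀ {k} (xs : Vec A (suc k)) c i →
                  lookup (removeAt xs c) i ≡ lookup xs (punchIn c i)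
lookup-removeAt (_ ∷ _)          zero    _       = refl
lookup-removeAt (_ ∷ _ ∷ _)      (suc _) zero    = refl
lookup-removeAt (_ ∷ xs@(_ ∷ _)) (suc c) (suc i) = lookup-removeAt xs c i

module _ {A : Set} where

  removeAt-injective : ∀ {k} {xs : Vec A (suc k)} → Injective _≡_ _≡_ (lookup xs) →
                       ∀ c → Injective _≡_ _≡_ (lookup (removeAt xs c))
  removeAt-injective {xs = xs} inj c {i} {j} eq = punchIn-injective c i j
    (inj (trans (sym (lookup-removeAt xs c i)) (trans eq (lookup-removeAt xs c j))))

  decodeFrom-injective : ∀ {k} {xs : Vec A k} → Injective _≡_ _≡_ (lookup xs) →
                         Injective _≡_ _≡_ (decodeFrom xs)
  decodeFrom-injective {zero}  {[]} _   _  = refl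
  decodeFrom-injective {suc k} {xs} inj {c , _} eq with inj (∷-injectiveˡ eq)
  ... | refl =
    cong (c ,_) (decodeFrom-injective {k} (removeAt-injective {xs = xs} inj c) (∷-injectiveʳ eq))

  decodeFrom-⊆ : ∀ {k} (xs : Vec A k) cs →
                 All (λ y → ∃[ i ] lookup xs i ≡ y) (toList (decodeFrom xs cs))
  decodeFrom-⊆ {zero}  [] _        = []
  decodeFrom-⊆ {suc k} xs (c , cs) = (c , refl) ∷
    All.map (λ { (i , refl) → punchIn c i , sym (lookup-removeAt xs c i) })
            (decodeFrom-⊆ (removeAt xs c) cs)

  decodeFrom-unique : ∀ {k} {xs : Vec A k} → Injective _≡_ _≡_ (lookup xs) →
                      ∀ cs → Unique (toList (decodeFrom xs cs))
  decodeFrom-unique {zero}  {[]} _   _        = []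
  decodeFrom-unique {suc k} {xs} inj (c , cs) =
    All.map (λ { (i , refl) eq → punchInᵢ≢i c i (inj (trans (sym (lookup-removeAt xs c i)) (sym eq))) })
            (decodeFrom-⊆ (removeAt xs c) cs)
    ∷ decodeFrom-unique (removeAt-injective {xs = xs} inj c) cs

  decodeFrom-surjective : ∀ {k} {xs : Vec A k} → Injective _≡_ _≡_ (lookup xs) →
    ∀ ys → Unique (toList ys) → All (λ y → ∃[ i ] lookup xs i ≡ y) (toList ys) →
    ∃[ cs ] decodeFrom xs cs ≡ ys
  decodeFrom-surjective {zero}  {[]} _   []       _                 _                  = tt , refl
  decodeFrom-surjective {suc k} {xs} inj (y ∷ ys) (y∉ys ∷ ys-unique) ((c , refl) ∷ ys⊆xs) =
    let cs , eq = decodeFrom-surjective (removeAt-injective {xs = xs} inj c) ys ys-unique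
                    (All.zipWith ⊆removeAt (y∉ys , ys⊆xs))
    in (c , cs) , cong (y ∷_) eq
    where
    ⊆removeAt : ∀ {z} → y ≢ z × (∃[ j ] lookup xs j ≡ z) → ∃[ i ] lookup (removeAt xs c) i ≡ z
    ⊆removeAt (y≢z , j , refl) = punchOut c≢j , removeAt-punchOut xs c≢j
      where
      c≢j : c ≢ j
      c≢j refl = y≢z refl

allFin-lookup-injective : ∀ n → Injective _≡_ _≡_ (lookup (Vec.allFin n))
allFin-lookup-injective n {i} {j} eq = trans (sym (lookup-allFin i)) (trans eq (lookup-allFin j))

decode-injective : ∀ {n} → Injective _≡_ _≡_ (decode {n})
decode-injective {n} = decodeFrom-injective (allFin-lookup-injective n)

decode-isPerm : ∀ {n} (c : Code n) → IsPerm (decode c)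
decode-isPerm {n} = decodeFrom-unique (allFin-lookup-injective n)

decode-surjective : ∀ {n} (σ : Vec (Fin n) n) → IsPerm σ → ∃[ c ] decode c ≡ σ
decode-surjective {n} σ σ-perm = decodeFrom-surjective (allFin-lookup-injective n) σ σ-perm
  (All.tabulate (λ {y} _ → y , lookup-allFin y))

≤ᵇ≡<ᵇsuc : ∀ m n → (m ≤ᵇ n) ≡ (m <ᵇ suc n)
≤ᵇ≡<ᵇsuc zero    n = refl
≤ᵇ≡<ᵇsuc (suc m) n = refl

countPrefix : {A : Set} → (A → Bool) → ∀ {k} → Vec A k → ℕ → ℕ
countPrefix p []       _       = 0
countPrefix p (_ ∷ _)  zero    = 0
countPrefix p (x ∷ xs) (suc m) = 𝟙 (p x) + countPrefix p xs m

∑-allFin≡countPrefix : {A : Set} (p : A → Bool) → ∀ {k} (xs : Vec A k) m →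
  ∑[ i ∈ allFin k ] 𝟙 ((toℕ i <ᵇ m) ∧ p (lookup xs i)) ≡ countPrefix p xs m
∑-allFin≡countPrefix p         []       _       = refl
∑-allFin≡countPrefix p {suc k} (_ ∷ _)  zero    =
  trans (∑-const 0 (allFin (suc k))) (*-zeroʳ (length (allFin (suc k))))
∑-allFin≡countPrefix p         (x ∷ xs) (suc m) =
  trans (∑-allFin-suc (λ i → 𝟙 ((toℕ i <ᵇ suc m) ∧ p (lookup (x ∷ xs) i))))
        (cong (𝟙 (p x) +_) (∑-allFin≡countPrefix p xs m))

rank≡countPrefix : ∀ {n} (σ : Vec (Fin n) n) a b →
                   rank σ a b ≡ countPrefix (λ j → toℕ j ≤ᵇ toℕ b) σ (suc (toℕ a))
rank≡countPrefix {n} σ a b = begin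
  rank σ a b
    ≡⟨ length-filter≡∑ _ (allFin n) ⟩
  ∑[ i ∈ allFin n ] 𝟙 ((toℕ i ≤ᵇ toℕ a) ∧ (toℕ (lookup σ i) ≤ᵇ toℕ b))
    ≡⟨ ∑-cong (allFin n) (λ i → cong (λ t → 𝟙 (t ∧ _)) (≤ᵇ≡<ᵇsuc (toℕ i) (toℕ a))) ⟩
  ∑[ i ∈ allFin n ] 𝟙 ((toℕ i <ᵇ suc (toℕ a)) ∧ (toℕ (lookup σ i) ≤ᵇ toℕ b))
    ≡⟨ ∑-allFin≡countPrefix _ σ (suc (toℕ a)) ⟩
  countPrefix (λ j → toℕ j ≤ᵇ toℕ b) σ (suc (toℕ a)) ∎
  where open ≡-Reasoning

-- leftBelow c k = k − [c < k]: how many of the positions below k survive deleting position c.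
leftBelow : ∀ {m} → Fin m → ℕ → ℕ
leftBelow _       zero    = zero
leftBelow zero    (suc k) = k
leftBelow (suc c) (suc k) = suc (leftBelow c k)

toℕ-punchIn-<ᵇ : ∀ {m} (c : Fin (suc m)) (i : Fin m) k →
                 (toℕ (punchIn c i) <ᵇ k) ≡ (toℕ i <ᵇ leftBelow c k)
toℕ-punchIn-<ᵇ _       _       zero    = refl
toℕ-punchIn-<ᵇ zero    _       (suc k) = refl
toℕ-punchIn-<ᵇ (suc c) zero    (suc k) = refl
toℕ-punchIn-<ᵇ (suc c) (suc i) (suc k) = toℕ-punchIn-<ᵇ c i k

𝟙<ᵇ+leftBelow : ∀ {m} (c : Fin m) k → 𝟙 (toℕ c <ᵇ k) + leftBelow c k ≡ k
𝟙<ᵇ+leftBelow _       zero    = refl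
𝟙<ᵇ+leftBelow zero    (suc k) = refl
𝟙<ᵇ+leftBelow (suc c) (suc k) = trans (+-suc (𝟙 (toℕ c <ᵇ k)) _) (cong suc (𝟙<ᵇ+leftBelow c k))

pred≤leftBelow : ∀ {m} (c : Fin m) k → pred k ≤ leftBelow c k
pred≤leftBelow _       zero          = z≤n
pred≤leftBelow zero    (suc k)       = ≤-refl
pred≤leftBelow (suc c) (suc zero)    = z≤n
pred≤leftBelow (suc c) (suc (suc k)) = s≤s (pred≤leftBelow c (suc k))

leftBelow-mono : ∀ {m} {c c′ : Fin m} {k k′} → c Fin.≤ c′ → k ≤ k′ → leftBelow c k ≤ leftBelow c′ k′
leftBelow-mono {c = _}     {_}      _         z≤n        = z≤n
leftBelow-mono {c = zero}  {c′}     _         (s≤s k≤k′) = ≤-trans k≤k′ (pred≤leftBelow c′ (suc _))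
leftBelow-mono {c = suc c} {suc c′} (s≤s c≤c′) (s≤s k≤k′) = s≤s (leftBelow-mono c≤c′ k≤k′)

leftBelowAfter : ∀ {j} → Code j → ℕ → ℕ → ℕ
leftBelowAfter {zero}  _        k _       = k
leftBelowAfter {suc j} _        k zero    = k
leftBelowAfter {suc j} (c , cs) k (suc m) = leftBelowAfter cs (leftBelow c k) m

leftBelowAfter-mono : ∀ {j} {cs cs′ : Code j} {k k′} → CodeRel Fin._≤_ cs cs′ → k ≤ k′ →
                      ∀ m → leftBelowAfter cs k m ≤ leftBelowAfter cs′ k′ m
leftBelowAfter-mono {zero}  _                   k≤k′ _       = k≤k′
leftBelowAfter-mono {suc j} _                   k≤k′ zero    = k≤k′
leftBelowAfter-mono {suc j} (c≤c′ , cs≤cs′) k≤k′ (suc m) =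
  leftBelowAfter-mono {j} cs≤cs′ (leftBelow-mono c≤c′ k≤k′) m

HoldsExactlyOnFirst : {A : Set} → (A → Bool) → ℕ → ∀ {j} → Vec A j → Set
HoldsExactlyOnFirst p k xs = ∀ i → p (lookup xs i) ≡ (toℕ i <ᵇ k)

module _ {A : Set} {p : A → Bool} where

  removeAt-holdsExactlyOnFirst : ∀ {j k} {xs : Vec A (suc j)} → HoldsExactlyOnFirst p k xs →
                                 ∀ c → HoldsExactlyOnFirst p (leftBelow c k) (removeAt xs c)
  removeAt-holdsExactlyOnFirst {k = k} {xs} p-first c i = begin
    p (lookup (removeAt xs c) i)  ≡⟨ cong p (lookup-removeAt xs c i) ⟩
    p (lookup xs (punchIn c i))   ≡⟨ p-first (punchIn c i) ⟩
    toℕ (punchIn c i) <ᵇ k        ≡⟨ toℕ-punchIn-<ᵇ c i k ⟩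
    toℕ i <ᵇ leftBelow c k        ∎
    where open ≡-Reasoning

  countPrefix-decodeFrom : ∀ {j k} {xs : Vec A j} → HoldsExactlyOnFirst p k xs →
    ∀ cs m → countPrefix p (decodeFrom xs cs) m + leftBelowAfter cs k m ≡ k
  countPrefix-decodeFrom {zero}      {xs = []} _       _        _       = refl
  countPrefix-decodeFrom {suc j}                _       _        zero    = refl
  countPrefix-decodeFrom {suc j} {k} {xs}       p-first (c , cs) (suc m) = begin
    𝟙 (p (lookup xs c)) + countPrefix p rest m + leftBelowAfter cs (leftBelow c k) m
      ≡⟨ +-assoc (𝟙 (p (lookup xs c))) _ _ ⟩
    𝟙 (p (lookup xs c)) + (countPrefix p rest m + leftBelowAfter cs (leftBelow c k) m)
      ≡⟨ cong₂ (λ b r → 𝟙 b + r) (p-first c)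
               (countPrefix-decodeFrom {j} (removeAt-holdsExactlyOnFirst {k = k} {xs} p-first c) cs m) ⟩
    𝟙 (toℕ c <ᵇ k) + leftBelow c k
      ≡⟨ 𝟙<ᵇ+leftBelow c k ⟩
    k ∎
    where
    open ≡-Reasoning
    rest : Vec A j
    rest = decodeFrom (removeAt xs c) cs

decode-monotone : ∀ {n} {c c′ : Code n} → CodeRel Fin._≤_ c c′ → decode c ≤B decode c′
decode-monotone {n} {c} {c′} c≤c′ a b =
  subst₂ _≤_ (sym (rank≡countPrefix (decode c′) a b)) (sym (rank≡countPrefix (decode c) a b))
    (+-cancelʳ-≤ (left c) _ _ (begin
      countPrefix p (decode c′) m + left c   ≤⟨ +-monoʳ-≤ _ (leftBelowAfter-mono {n} c≤c′ ≤-refl m) ⟩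
      countPrefix p (decode c′) m + left c′  ≡⟨ countPrefix-decodeFrom small-first c′ m ⟩
      suc (toℕ b)                            ≡⟨ countPrefix-decodeFrom small-first c m ⟨
      countPrefix p (decode c) m + left c    ∎))
  where
  open ≤-Reasoning
  p : Fin n → Bool
  p j = toℕ j ≤ᵇ toℕ b
  m : ℕ
  m = suc (toℕ a)
  left : Code n → ℕ
  left d = leftBelowAfter d (suc (toℕ b)) m
  small-first : HoldsExactlyOnFirst p (suc (toℕ b)) (Vec.allFin n)
  small-first i = trans (cong p (lookup-allFin i)) (≤ᵇ≡<ᵇsuc (toℕ i) (toℕ b))

allVecs-suc : ∀ n k → allVecs n (suc k) ≡ cartesianProductWith _∷_ (allFin n) (allVecs n k)
allVecs-suc n k = go (allFin n)
  where
  go : ∀ is → concatMap (λ i → map (i ∷_) (allVecs n k)) is ≡ cartesianProductWith _∷_ is (allVecs n k)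
  go []       = refl
  go (i ∷ is) = cong (map (i ∷_) (allVecs n k) ++_) (go is)

∈-allVecs : ∀ {n k} (v : Vec (Fin n) k) → v ∈ allVecs n k
∈-allVecs         []      = here refl
∈-allVecs {n} {suc k} (i ∷ v) = subst (i ∷ v ∈_) (sym (allVecs-suc n k))
  (∈-cartesianProductWith⁺ _∷_ (∈-allFin i) (∈-allVecs v))

allVecs-unique : ∀ n k → Unique (allVecs n k)
allVecs-unique n zero    = [] ∷ []
allVecs-unique n (suc k) = subst Unique (sym (allVecs-suc n k))
  (Unique.cartesianProductWith⁺ _∷_ (λ eq → ∷-injectiveˡ eq , ∷-injectiveʳ eq)
                                (Unique.allFin⁺ n) (allVecs-unique n k))

perms↭map-decode : ∀ n → perms n ↭ map decode (codes n)
perms↭map-decode n = ∼bag⇒↭ (unique∧set⇒bag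
  (Unique.filter⁺ isPerm? (allVecs-unique n n))
  (Unique.map⁺ decode-injective (codes-unique n))
  (mk⇔ to from))
  where
  to : ∀ {σ} → σ ∈ perms n → σ ∈ map decode (codes n)
  to {σ} σ∈perms with decode-surjective σ (proj₂ (∈-filter⁻ isPerm? {xs = allVecs n n} σ∈perms))
  ... | c , refl = ∈-map⁺ decode (∈-codes c)
  from : ∀ {σ} → σ ∈ map decode (codes n) → σ ∈ perms n
  from σ∈decodes with ∈-map⁻ decode σ∈decodes
  ... | c , _ , refl = ∈-filter⁺ isPerm? (∈-allVecs (decode c)) (decode-isPerm c)

codePairs : ∀ n → List (Code n × Code n)
codePairs n = cartesianProduct (codes n) (codes n)

∑-pairs : ∀ n (h : Vec (Fin n) n → Vec (Fin n) n → ℕ) →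
  ∑[ p ∈ pairs n ] h (proj₁ p) (proj₂ p) ≡
  ∑[ p ∈ codePairs n ] h (decode (proj₁ p)) (decode (proj₂ p))
∑-pairs n h = begin
  ∑[ p ∈ pairs n ] h (proj₁ p) (proj₂ p)
    ≡⟨ ∑-cartesianProduct _ (perms n) (perms n) ⟩
  ∑[ π ∈ perms n ] ∑[ τ ∈ perms n ] h π τ
    ≡⟨ ∑-cong (perms n) (λ π → ∑-perms (h π)) ⟩
  ∑[ π ∈ perms n ] ∑[ d ∈ codes n ] h π (decode d)
    ≡⟨ ∑-perms _ ⟩
  ∑[ c ∈ codes n ] ∑[ d ∈ codes n ] h (decode c) (decode d)
    ≡⟨ ∑-cartesianProduct _ (codes n) (codes n) ⟨
  ∑[ p ∈ codePairs n ] h (decode (proj₁ p)) (decode (proj₂ p)) ∎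
  where
  open ≡-Reasoning
  ∑-perms : ∀ f → ∑ (perms n) f ≡ ∑ (codes n) (f ∘ decode)
  ∑-perms f = trans (∑-↭ f (perms↭map-decode n)) (∑-map f decode (codes n))

codeIndicator : ∀ {n} → Event n → Code n × Code n → ℕ
codeIndicator E (c , d) = 𝟙 (E (decode c) (decode d))

card≡∑-codeIndicator : ∀ {n} (E : Event n) → card E ≡ ∑ (codePairs n) (codeIndicator E)
card≡∑-codeIndicator {n} E = trans (length-filter≡∑ _ (pairs n)) (∑-pairs n (λ π τ → 𝟙 (E π τ)))

length-pairs : ∀ n → length (pairs n) ≡ length (codePairs n)
length-pairs n =
  trans (length≡∑1 (pairs n)) (trans (∑-pairs n (λ _ _ → 1)) (sym (length≡∑1 (codePairs n))))

CodePairOrder : ∀ {n} → Rel (Code n × Code n) 0ℓ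
CodePairOrder = Pointwise (CodeRel Fin._≤_) (CodeRel Fin._≥_)

codeIndicator-monotone : ∀ {n} {E : Event n} → IncreasingFst E → DecreasingSnd E →
                         codeIndicator E Preserves CodePairOrder ⟶ _≤_
codeIndicator-monotone {n} inc dec {c , d} {c′ , d′} (c≤c′ , d≥d′) = 𝟙-mono λ E-cd →
  dec (decode c′) (decode d) (decode d′) (decode-isPerm c′) (decode-isPerm d) (decode-isPerm d′)
      (decode-monotone (CodeRel-≥⇒≤ {n} d≥d′))
      (inc (decode c) (decode c′) (decode d) (decode-isPerm c) (decode-isPerm c′) (decode-isPerm d)
           (decode-monotone c≤c′) E-cd)

harris-codePairs : ∀ n → HarrisProperty CodePairOrder (codePairs n)
harris-codePairs n =
  harris-× (CodeRel-refl Fin.≤-refl {n}) (CodeRel-refl Fin.≤-refl {n}) {codes n} {codes n}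
    (harris-codes Fin.≤-refl Fin.≤-total n)
    (harris-codes {R = Fin._≥_} Fin.≤-refl (flip Fin.≤-total) n)

corollary4p5 : (n : ℕ) (A B : Event n) →
    IncreasingFst A → DecreasingSnd A →
    IncreasingFst B → DecreasingSnd B →
    card A * card B ≤ card (A ∩ B) * length (pairs n)
corollary4p5 n A B inc-A dec-A inc-B dec-B = begin
  card A * card B
    ≡⟨ cong₂ _*_ (card≡∑-codeIndicator A) (card≡∑-codeIndicator B) ⟩
  ∑ (codePairs n) (codeIndicator A) * ∑ (codePairs n) (codeIndicator B)
    ≤⟨ harris-codePairs n _ _ (codeIndicator-monotone inc-A dec-A)
                              (codeIndicator-monotone inc-B dec-B) ⟩
  length (codePairs n) * ∑[ p ∈ codePairs n ] (codeIndicator A p * codeIndicator B p)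
    ≡⟨ cong₂ _*_ (length-pairs n) (trans (card≡∑-codeIndicator (A ∩ B)) (∑-cong (codePairs n) both)) ⟨
  length (pairs n) * card (A ∩ B)
    ≡⟨ *-comm (length (pairs n)) _ ⟩
  card (A ∩ B) * length (pairs n) ∎
  where
  open ≤-Reasoning
  both : ∀ p → codeIndicator (A ∩ B) p ≡ codeIndicator A p * codeIndicator B p
  both (c , d) = 𝟙-∧ (A (decode c) (decode d)) (B (decode c) (decode d))
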